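{- For positive integers $m,n$, let $K_m^1$ and $K_n^1$ be the complete with 1-pendant ordered graphs on $m+1$ and $n+1$ vertices respectively. Then $r_<(K_m^1,K_n^1)\le R(m,n)+m+n-1$, where $R(m,n)$ is the classical Ramsey number.
   Context: An ordered graph on $k$ vertices is a graph with vertex set $[k]=\{1,\dots,k\}$ with the natural order. For an integer $k\ge1$, $K_k^1$ denotes the ordered graph on vertex set $\{1,\dots,k+1\}$ whose edges are all pairs $\{i,j\}$ with $2\le i<j\le k+1$ together with the edge $\{1,2\}$ (a complete graph on $\{2,\dots,k+1\}$ with a pendant edge from vertex $1$ to vertex $2$). Given a red/blue coloring of the edges of the complete graph on $[N]$, a red (resp. blue) ordered copy of an ordered graph $H$ on $[k]$ is a strictly increasing map $\phi:[k]\to[N]$ such that every edge $\{\phi(i),\phi(j)\}$ with $\{i,j\}\in E(H)$ is red (resp. blue). The ordered Ramsey number $r_<(H_1,H_2)$ is the least $N$ such that every red/blue coloring of the edges of the complete graph on $[N]$ contains a red ordered copy of $H_1$ or a blue ordered copy of $H_2$. $R(m,n)$ is the least $N$ such that every red/blue coloring of the edges of $K_N$ contains a red $K_m$ or a blue $K_n$. -}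

module Defs where

open import Data.Nat using (ℕ; suc; _+_; _∸_; _≤_; _<_)
open import Data.Fin using (Fin; toℕ; fromℕ; zero) renaming (_<_ to _<ᶠ_; suc to fsuc)
open import Data.Bool using (Bool; true; false; _∧_; _∨_)
open import Data.Product using (Σ; _×_; ∃-syntax)
open import Data.Sum using (_⊎_)
open import Relation.Binary.PropositionalEquality using (_≡_)

-- Ordered graph on vertex set Fin k (i.e. [k] with the natural order),
-- given by an adjacency function; only pairs i < j are consulted.
OrderedGraph : ℕ → Set
OrderedGraph k = Fin k → Fin k → Bool

-- red/blue colouring of the edges of the complete graph on [N]:
-- the colour of edge {x,y} with x < y is  c x y  (true = red, false = blue).
Colouring : ℕ → Set
Colouring N = Fin N → Fin N → Bool

red blue : Bool
red = true
blue = false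

StrictlyIncreasing : ∀ {k N} → (Fin k → Fin N) → Set
StrictlyIncreasing φ = ∀ i j → i <ᶠ j → φ i <ᶠ φ j

OrderedCopy : ∀ {k N} → Colouring N → Bool → OrderedGraph k → Set
OrderedCopy {k} {N} c col H =
  Σ (Fin k → Fin N) λ φ → StrictlyIncreasing φ ×
    (∀ i j → i <ᶠ j → H i j ≡ true → c (φ i) (φ j) ≡ col)

OrderedArrows : ∀ {k l} → ℕ → OrderedGraph k → OrderedGraph l → Set
OrderedArrows N H₁ H₂ = (c : Colouring N) → OrderedCopy c red H₁ ⊎ OrderedCopy c blue H₂

IsOrderedRamseyNumber : ∀ {k l} → OrderedGraph k → OrderedGraph l → ℕ → Set
IsOrderedRamseyNumber H₁ H₂ r = OrderedArrows r H₁ H₂ × (∀ N → OrderedArrows N H₁ H₂ → r ≤ N)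

complete : (k : ℕ) → OrderedGraph k
complete k i j = true

-- K_k^1 on vertex set Fin (suc k) (vertex 1 of the paper = Fin index 0):
-- complete on indices 1..k, plus edge {0,1}.
isZero : ∀ {n} → Fin n → Bool
isZero zero = true
isZero (fsuc _) = false

isOne : ∀ {n} → Fin n → Bool
isOne zero = false
isOne (fsuc i) = isZero i

KPendant : (k : ℕ) → OrderedGraph (suc k)
KPendant k i j = ((isZero i ∨ isZero j) ∧ (isOne i ∨ isOne j)) ∨ ((not0 i) ∧ (not0 j))
  where
  not0 : ∀ {n} → Fin n → Bool
  not0 zero = false
  not0 (fsuc _) = true

-- classical (unordered) Ramsey: a monochromatic K_m in a colouring, as an
-- m-subset of [N]. Listing the subset increasingly loses nothing.
Clique : ∀ {N} → Colouring N → Bool → ℕ → Set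
Clique c col m = OrderedCopy c col (complete m)

ClassicalArrows : ℕ → ℕ → ℕ → Set
ClassicalArrows N m n = (c : Colouring N) → Clique c red m ⊎ Clique c blue n

IsRamseyNumber : ℕ → ℕ → ℕ → Set
IsRamseyNumber m n R = ClassicalArrows R m n × (∀ N → ClassicalArrows N m n → R ≤ N)

-- Call a vertex v left-monochromatic in a colour if every edge uv with u < v has that colour.
-- Left-monochromatic vertices of one colour span a clique of that colour, and the first vertex is
-- vacuously left-monochromatic in both colours. Among N = R(m,n) + m + n − 1 vertices either m + 1
-- are left-monochromatic in red, giving a red K_{m+1} ⊇ K_m^1, or R(m,n) + n − 1 are not; among
-- those either n are left-monochromatic in blue, or R(m,n) are left-monochromatic in neither colour
-- and carry a red K_m or a blue K_n. In each remaining case the first vertex v of the clique is not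
-- left-monochromatic in the other colour, so some earlier u has uv in the colour of the clique, and
-- u is the pendant vertex.
module Submission where

open import Defs
open import Data.Nat using (ℕ; suc; _+_; _∸_; _≤_; _<_; zero; z≤n; s≤s)
open import Data.Nat.Properties using (≤-refl; ≤-trans; ≤-reflexive; <⇒≤; <-≤-trans; +-suc; +-comm; m≤n+m∸n)
open import Data.Nat.Tactic.RingSolver using (solve-∀)
open import Data.Fin using (Fin; toℕ) renaming (_<_ to _<ᶠ_; suc to fsuc; zero to fzero; _<?_ to _<ᶠ?_)
open import Data.Fin.Properties using (all?; any?)
open import Data.Vec.Functional using (_∷_)
open import Data.Bool using (Bool; true; not)
open import Data.Bool.Properties using (¬-not) renaming (_≟_ to _≟ᵇ_)
open import Data.Product using (Σ; _×_; _,_; proj₁; proj₂; ∃-syntax)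
open import Data.Sum using (_⊎_; inj₁; inj₂)
open import Level using (Level)
open import Relation.Nullary using (¬_; yes; no; contradiction)
open import Relation.Nullary.Decidable using (_×-dec_; _→-dec_)
open import Relation.Unary using (Pred; Decidable; ∁)
open import Relation.Binary.PropositionalEquality using (_≡_; refl; subst)

private
  variable
    p q : Level
    k l N : ℕ

∷-increasing : (y : Fin N) (φ : Fin k → Fin N) → StrictlyIncreasing φ →
  (∀ i → y <ᶠ φ i) → StrictlyIncreasing (y ∷ φ)
∷-increasing y φ inc y<φ fzero    (fsuc j) _       = y<φ j
∷-increasing y φ inc y<φ (fsuc i) (fsuc j) (s≤s i<j) = inc i j i<j

head-≤ : (φ : Fin (suc k) → Fin N) → StrictlyIncreasing φ → ∀ i → toℕ (φ fzero) ≤ toℕ (φ i)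
head-≤ φ inc fzero    = ≤-refl
head-≤ φ inc (fsuc i) = <⇒≤ (inc fzero (fsuc i) (s≤s z≤n))

IncreasingSelection : ℕ → Pred (Fin N) p → Set p
IncreasingSelection {N} k P =
  Σ (Fin k → Fin N) λ φ → StrictlyIncreasing φ × (∀ i → P (φ i))

module _ {P : Pred (Fin N) p} where

  emptySelection : IncreasingSelection 0 P
  emptySelection = (λ ()) , (λ ()) , (λ ())

  ∷-selection : (y : Fin N) → P y → (s : IncreasingSelection k P) →
    (∀ i → y <ᶠ proj₁ s i) → IncreasingSelection (suc k) P
  ∷-selection y Py (φ , inc , sat) y<φ =
    y ∷ φ , ∷-increasing y φ inc y<φ , λ { fzero → Py ; (fsuc i) → sat i }

  refine : {Q : Pred (Fin N) q} (s : IncreasingSelection k P) →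
    IncreasingSelection l (λ i → Q (proj₁ s i)) → IncreasingSelection l (λ v → P v × Q v)
  refine (φ , φ-inc , φ-sat) (χ , χ-inc , χ-sat) =
    (λ i → φ (χ i)) , (λ i j i<j → φ-inc (χ i) (χ j) (χ-inc i j i<j)) ,
    λ i → φ-sat (χ i) , χ-sat i

module _ {P : Pred (Fin (suc N)) p} where

  shift : IncreasingSelection k (λ v → P (fsuc v)) → IncreasingSelection k P
  shift (φ , inc , sat) = (λ i → fsuc (φ i)) , (λ i j i<j → s≤s (inc i j i<j)) , sat

  cons-zero : P fzero → IncreasingSelection k (λ v → P (fsuc v)) → IncreasingSelection (suc k) P
  cons-zero P0 s = ∷-selection {P = P} fzero P0 (shift s) (λ i → s≤s z≤n)

pigeonhole : (P : Pred (Fin N) p) → Decidable P → ∀ a b → a + b ≤ suc N →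
  IncreasingSelection a P ⊎ IncreasingSelection b (∁ P)
pigeonhole P P? zero b _ = inj₁ (emptySelection {P = P})
pigeonhole P P? (suc a) zero _ = inj₂ (emptySelection {P = ∁ P})
pigeonhole {zero} P P? (suc a) (suc b) (s≤s h) with subst (_≤ 0) (+-suc a b) h
... | ()
pigeonhole {suc N} P P? (suc a) (suc b) (s≤s h) with P? fzero
... | yes P0 with pigeonhole (λ v → P (fsuc v)) (λ v → P? (fsuc v)) a (suc b) h
...   | inj₁ s = inj₁ (cons-zero {P = P} P0 s)
...   | inj₂ s = inj₂ (shift {P = ∁ P} s)
pigeonhole {suc N} P P? (suc a) (suc b) (s≤s h) | no ¬P0
  with pigeonhole (λ v → P (fsuc v)) (λ v → P? (fsuc v)) (suc a) b
         (subst (_≤ suc N) (+-suc a b) h)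
...   | inj₁ s = inj₁ (shift {P = P} s)
...   | inj₂ s = inj₂ (cons-zero {P = ∁ P} ¬P0 s)

clique⇒copy : {c : Colouring N} {col : Bool} {H : OrderedGraph k} →
  Clique c col k → OrderedCopy c col H
clique⇒copy (φ , inc , edges) = φ , inc , λ i j i<j _ → edges i j i<j refl

clique-lift : {c : Colouring N} {col : Bool} (g : Fin l → Fin N) → StrictlyIncreasing g →
  Clique (λ x y → c (g x) (g y)) col k → Clique c col k
clique-lift g g-inc (φ , inc , edges) =
  (λ i → g (φ i)) , (λ i j i<j → g-inc (φ i) (φ j) (inc i j i<j)) , edges

pendant-extend : {c : Colouring N} {col : Bool} (cl : Clique c col (suc k)) (u : Fin N) →
  u <ᶠ proj₁ cl fzero → c u (proj₁ cl fzero) ≡ col → OrderedCopy c col (KPendant (suc k))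
pendant-extend {k = k} {c = c} {col} (φ , inc , edges) u u<φ₀ pendant =
  u ∷ φ , ∷-increasing u φ inc (λ i → <-≤-trans u<φ₀ (head-≤ φ inc i)) , edge
  where
  edge : ∀ i j → i <ᶠ j → KPendant (suc k) i j ≡ true → c ((u ∷ φ) i) ((u ∷ φ) j) ≡ col
  edge fzero    (fsuc fzero)    _         _ = pendant
  edge fzero    (fsuc (fsuc j)) _         ()
  edge (fsuc i) (fsuc j)        (s≤s i<j) _ = edges i j i<j refl

module _ (c : Colouring N) where

  LeftMonochromatic : Bool → Pred (Fin N) _
  LeftMonochromatic col v = ∀ u → u <ᶠ v → c u v ≡ col

  leftMonochromatic? : ∀ col → Decidable (LeftMonochromatic col)
  leftMonochromatic? col v = all? (λ u → (u <ᶠ? v) →-dec (c u v ≟ᵇ col))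

  earlier-neighbour : ∀ {col v} → ¬ LeftMonochromatic (not col) v →
    ∃[ u ] u <ᶠ v × c u v ≡ col
  earlier-neighbour {col} {v} ¬mono with any? (λ u → (u <ᶠ? v) ×-dec (c u v ≟ᵇ col))
  ... | yes found = found
  ... | no none = contradiction (λ u u<v → ¬-not (λ e → none (u , u<v , e))) ¬mono

  leftMonochromatic-clique : ∀ {col} →
    IncreasingSelection k (LeftMonochromatic col) → Clique c col k
  leftMonochromatic-clique (φ , inc , mono) = φ , inc , λ i j i<j _ → mono j (φ i) (inc i j i<j)

  pendant-from-clique : ∀ {col} (cl : Clique c col (suc k)) →
    ¬ LeftMonochromatic (not col) (proj₁ cl fzero) → OrderedCopy c col (KPendant (suc k))
  pendant-from-clique cl ¬mono with earlier-neighbour ¬mono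
  ... | u , u<v , pendant = pendant-extend {c = c} cl u u<v pendant

pendant-arrows : ∀ R m n N → R + suc m + suc n ≤ suc N → ClassicalArrows R (suc m) (suc n) →
  OrderedArrows N (KPendant (suc m)) (KPendant (suc n))
pendant-arrows R m n N size arrows c
  with pigeonhole (LeftMonochromatic c red) (leftMonochromatic? c red)
         (suc (suc m)) (R + n) (≤-trans (≤-reflexive (count R m n)) size)
  where
  count : ∀ R m n → suc (suc m) + (R + n) ≡ R + suc m + suc n
  count = solve-∀
... | inj₁ reds = inj₁ (clique⇒copy {c = c} (leftMonochromatic-clique c reds))
... | inj₂ notReds
  with pigeonhole (λ i → LeftMonochromatic c blue (proj₁ notReds i))
         (λ i → leftMonochromatic? c blue (proj₁ notReds i))
         (suc n) R (s≤s (≤-reflexive (+-comm n R)))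
... | inj₁ blues
  with refine {P = ∁ (LeftMonochromatic c red)} {Q = LeftMonochromatic c blue} notReds blues
...   | φ , inc , both = inj₂ (pendant-from-clique c blueClique (proj₁ (both fzero)))
  where
  blueClique : Clique c blue (suc n)
  blueClique = leftMonochromatic-clique c (φ , inc , λ i → proj₂ (both i))
pendant-arrows R m n N size arrows c | inj₂ notReds | inj₂ notBlues
  with refine {P = ∁ (LeftMonochromatic c red)} {Q = ∁ (LeftMonochromatic c blue)} notReds notBlues
... | g , g-inc , neither with arrows (λ x y → c (g x) (g y))
...   | inj₁ cl = inj₁ (pendant-from-clique c (clique-lift {c = c} g g-inc cl)
                         (proj₂ (neither (proj₁ cl fzero))))
...   | inj₂ cl = inj₂ (pendant-from-clique c (clique-lift {c = c} g g-inc cl)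
                         (proj₁ (neither (proj₁ cl fzero))))

proposition5p2 : (m n : ℕ) → 0 < m → 0 < n → (R r : ℕ) →
    IsRamseyNumber m n R →
    IsOrderedRamseyNumber (KPendant m) (KPendant n) r →
    r ≤ R + m + n ∸ 1
proposition5p2 (suc m) (suc n) _ _ R r (arrows , _) (_ , minimal) =
  minimal (R + suc m + suc n ∸ 1)
    (pendant-arrows R m n _ (m≤n+m∸n (R + suc m + suc n) 1) arrows)
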